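{- For the maximin support problem, the approximation ratio offered by the sequential Phragmén algorithm is no better than the $k$-th harmonic number $H_k=\sum_{i=1}^k 1/i$: for every $k\ge1$, the supremum, over election instances with committee size $k$, of $\mathrm{OPT}/\mathrm{supp}_w(A)$, where $(A,w)$ is the output of the sequential Phragmén algorithm, is at least $H_k$.
   Context: An election instance consists of a finite bipartite graph $G=(N\cup C,E)$ with no isolated vertices ($N$ = voters, $C$ = candidates), a vector $s\in\mathbb{R}^N$ of non-negative vote strengths, and an integer $k$ with $0<k<|C|$. Write $nc$ for $\{n,c\}$, $C_n=\{c: nc\in E\}$, $N_c=\{n: nc\in E\}$. A weight vector $w\in\mathbb{R}^E$ is feasible if $w\ge0$ and $\sum_{c\in C_n}w_{nc}\le s_n$ for all $n$. $\mathrm{supp}_w(c)=\sum_{n\in N_c}w_{nc}$, $\mathrm{supp}_w(A)=\min_{c\in A}\mathrm{supp}_w(c)$. The maximin support problem maximizes $\mathrm{supp}_w(A)$ over pairs $(A,w)$ with $|A|=k$ and $w$ feasible; OPT is the optimal value. Sequential Phragmén algorithm: initialize $A=\emptyset$, $w=0\in\mathbb{R}^E$, $\mathrm{load}(n)=0$ for $n\in N$, $\mathrm{load}(c')=0$ for $c'\in C$. For $i=1,\dots,k$: for each $c'\in C\setminus A$ set $\mathrm{load}(c')=\big(1+\sum_{n\in N_{c'}}s_n\mathrm{load}(n)\big)/\sum_{n\in N_{c'}}s_n$; pick $c_{\min}\in\arg\min_{c'\in C\setminus A}\mathrm{load}(c')$; set $A\leftarrow A\cup\{c_{\min}\}$;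 for each $n\in N_{c_{\min}}$ set $w_{nc_{\min}}=\mathrm{load}(c_{\min})-\mathrm{load}(n)$ and then $\mathrm{load}(n)=\mathrm{load}(c_{\min})$. Finally, for each edge $nc$ with $w_{nc}>0$ set $w_{nc}\leftarrow w_{nc}\,s_n/\mathrm{load}(n)$, and return $(A,w)$. -}

module Defs where

open import Data.Nat as ℕ using (ℕ; zero; suc)
open import Data.Fin using (Fin; zero; suc; toℕ; _≟_)
open import Data.Bool using (Bool; true; false; if_then_else_)
open import Data.Integer using (+_)
open import Data.Rational using (ℚ; 0ℚ; 1ℚ; _+_; _*_; _-_; _≤_; _<_; _/_)
open import Data.Product using (Σ; ∃; _×_; _,_)
open import Relation.Binary.PropositionalEquality using (_≡_)
open import Relation.Nullary using (¬_; does)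

sumFin : (n : ℕ) → (Fin n → ℚ) → ℚ
sumFin zero    f = 0ℚ
sumFin (suc n) f = f zero + sumFin n (λ i → f (suc i))

count : (n : ℕ) → (Fin n → Bool) → ℕ
count zero    P = zero
count (suc n) P = (if P zero then 1 else 0) ℕ.+ count n (λ i → P (suc i))

harmonic : ℕ → ℚ
harmonic k = sumFin k (λ i → (+ 1) / suc (toℕ i))

record Election : Set where
  field
    nv nc    : ℕ
    edge     : Fin nv → Fin nc → Bool
    strength : Fin nv → ℚ
    strength-nonneg : ∀ n → 0ℚ ≤ strength n
    voter-nonisolated     : ∀ n → ∃ λ c → edge n c ≡ true
    candidate-nonisolated : ∀ c → ∃ λ n → edge n c ≡ true

module _ (El : Election) where
  open Election El

  -- Weight vectors in ℝ^E: functions on voter/candidate pairs that vanish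
  -- off the edge set.
  Weights : Set
  Weights = Fin nv → Fin nc → ℚ

  Committee : Set
  Committee = Fin nc → Bool

  Feasible : Weights → Set
  Feasible w =
      (∀ n c → 0ℚ ≤ w n c)
    × (∀ n c → edge n c ≡ false → w n c ≡ 0ℚ)
    × (∀ n → sumFin nc (λ c → if edge n c then w n c else 0ℚ) ≤ strength n)

  supp : Weights → Fin nc → ℚ
  supp w c = sumFin nv (λ n → if edge n c then w n c else 0ℚ)

  IsSuppOf : Weights → Committee → ℚ → Set
  IsSuppOf w A v =
      (∃ λ c → A c ≡ true × supp w c ≡ v)
    × (∀ c → A c ≡ true → v ≤ supp w c)

  -- Sequential Phragmén, as a relation (all tie-breaking choices allowed).

  approvalStrength : Fin nc → ℚ
  approvalStrength c = sumFin nv (λ n → if edge n c then strength n else 0ℚ)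

  loadedStrength : (Fin nv → ℚ) → Fin nc → ℚ
  loadedStrength ℓ c =
    sumFin nv (λ n → if edge n c then strength n * ℓ n else 0ℚ)

  data PhragmenState : ℕ → Committee → Weights → (Fin nv → ℚ) → Set where
    start : PhragmenState 0 (λ _ → false) (λ _ _ → 0ℚ) (λ _ → 0ℚ)
    step  : ∀ {i A w ℓ} → PhragmenState i A w ℓ →
            (cmin : Fin nc) → A cmin ≡ false →
            (L : Fin nc → ℚ) →
            (∀ c' → A c' ≡ false →
               L c' * approvalStrength c' ≡ 1ℚ + loadedStrength ℓ c') →
            (∀ c' → A c' ≡ false → L cmin ≤ L c') →
            PhragmenState (suc i)
              (λ c → if does (c ≟ cmin) then true else A c)
              (λ n c → if does (c ≟ cmin)
                         then (if edge n cmin then L cmin - ℓ n else w n c)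
                         else w n c)
              (λ n → if edge n cmin then L cmin else ℓ n)

  PhragmenOutput : ℕ → Committee → Weights → Set
  PhragmenOutput k A w' =
    Σ Weights λ w → Σ (Fin nv → ℚ) λ ℓ →
        PhragmenState k A w ℓ
      × (∀ n c → 0ℚ < w n c → w' n c * ℓ n ≡ w n c * strength n)
      × (∀ n c → ¬ (0ℚ < w n c) → w' n c ≡ w n c)

-- The witness is a "staircase" election with K = k voters 0..K-1 of unit
-- strength and K+1 candidates 0..K, where candidate c is approved by the
-- first deg c = max(c,1) voters.  Since every approval set is a prefix of
-- the voters, in each round all approvers of every unelected candidate carry
-- the same load t, and a candidate with S approvers then has Phragmén load
-- t + 1/S.  Hence Phragmén elects K, K-1, ..., 2 and finally 1 or 0 (a tie),
-- raising the load of voter 0 to 1/K + ... + 1/1 = H_K; the last candidate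
-- is backed by voter 0 alone, so after rescaling its support is 1/H_K.  The
-- committee {1..K}, each member backed fully by its own voter, has support 1.
module Submission where

open import Defs
open import Data.Nat using (ℕ; _<_)
open import Data.Product using (Σ; ∃; _×_)
open import Data.Rational using (ℚ; 0ℚ; _-_; _*_; _≤_) renaming (_<_ to _<ℚ_)
open import Relation.Binary.PropositionalEquality using (_≡_)

open import Data.Bool using (Bool; true; false; if_then_else_)
open import Data.Fin using (Fin; zero; suc; toℕ; inject₁; fromℕ; fromℕ<; _≟_)
open import Data.Fin.Properties
  using (toℕ-inject₁; toℕ-fromℕ; toℕ-fromℕ<; toℕ≤pred[n]; toℕ-injective; suc-injective)
import Data.Integer as ℤ
import Data.Integer.Properties as ℤ
open import Data.Nat as ℕ using (zero; suc; pred; _∸_; _<ᵇ_)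
import Data.Nat.Properties as ℕ
open import Data.Nat.Coprimality using (1-coprimeTo) renaming (sym to coprime-sym)
open import Data.Product using (_,_; proj₁; proj₂)
open import Data.Rational using (1ℚ; _+_; -_; mkℚ; _/_; _÷_; 1/_; *≤*; positive; nonNegative; NonZero)
open import Data.Rational.Properties hiding (_≟_)
open import Data.Rational.Solver using (module +-*-Solver)
open import Function using (_∘_; _⇔_; mk⇔; Equivalence)
open import Relation.Binary.PropositionalEquality
  using (_≢_; refl; sym; trans; cong; cong₂; subst; subst₂; module ≡-Reasoning)
open import Relation.Nullary using (¬_; Dec; does; yes; no; contradiction)
open import Relation.Nullary.Decidable using (dec-true; dec-false)
open import Relation.Nullary.Reflects using (ofʸ; ofⁿ)

open +-*-Solver using (solve; _:+_; _:-_; :-_; _:*_; _:=_; con)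


if-zero : ∀ b {x : ℚ} → x ≡ 0ℚ → (if b then x else 0ℚ) ≡ 0ℚ
if-zero true  x≡0 = x≡0
if-zero false _   = refl

if-off : ∀ {b} {x : ℚ} → b ≡ false → (if b then x else 0ℚ) ≡ 0ℚ
if-off refl = refl

if-nonneg : ∀ b {x : ℚ} → 0ℚ ≤ x → 0ℚ ≤ (if b then x else 0ℚ)
if-nonneg true  0≤x = 0≤x
if-nonneg false _   = ≤-refl

<ᵇ-true : ∀ {a b} → a < b → (a <ᵇ b) ≡ true
<ᵇ-true {a} {b} a<b with a <ᵇ b | ℕ.<ᵇ-reflects-< a b
... | true  | _       = refl
... | false | ofⁿ a≮b = contradiction a<b a≮b

<ᵇ-false : ∀ {a b} → b ℕ.≤ a → (a <ᵇ b) ≡ false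
<ᵇ-false {a} {b} b≤a with a <ᵇ b | ℕ.<ᵇ-reflects-< a b
... | true  | ofʸ a<b = contradiction a<b (ℕ.≤⇒≯ b≤a)
... | false | _       = refl

<ᵇ-sound : ∀ {a b} → (a <ᵇ b) ≡ true → a < b
<ᵇ-sound {a} {b} a<ᵇb with a <ᵇ b | ℕ.<ᵇ-reflects-< a b
<ᵇ-sound ()   | false | _
<ᵇ-sound refl | true  | ofʸ a<b = a<b


sumFin-cong : ∀ n {f g : Fin n → ℚ} → (∀ i → f i ≡ g i) → sumFin n f ≡ sumFin n g
sumFin-cong zero    f≡g = refl
sumFin-cong (suc n) f≡g = cong₂ _+_ (f≡g zero) (sumFin-cong n (f≡g ∘ suc))

sumFin-zeros : ∀ n {f : Fin n → ℚ} → (∀ i → f i ≡ 0ℚ) → sumFin n f ≡ 0ℚ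
sumFin-zeros zero    f≡0 = refl
sumFin-zeros (suc n) f≡0 =
  trans (cong₂ _+_ (f≡0 zero) (sumFin-zeros n (f≡0 ∘ suc))) (+-identityʳ 0ℚ)

sumFin-single : ∀ n {f : Fin n → ℚ} (j : Fin n) → (∀ i → i ≢ j → f i ≡ 0ℚ) →
                sumFin n f ≡ f j
sumFin-single (suc n) {f} zero    off =
  trans (cong (f zero +_) (sumFin-zeros n (λ i → off (suc i) (λ ())))) (+-identityʳ (f zero))
sumFin-single (suc n) {f} (suc j) off =
  trans (cong₂ _+_ (off zero (λ ())) (sumFin-single n j (λ i i≢j → off (suc i) (i≢j ∘ suc-injective))))
        (+-identityˡ (f (suc j)))

sumFin-*ʳ : ∀ n (f : Fin n → ℚ) x → sumFin n f * x ≡ sumFin n (λ i → f i * x)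
sumFin-*ʳ zero    f x = *-zeroˡ x
sumFin-*ʳ (suc n) f x =
  trans (*-distribʳ-+ x (f zero) (sumFin n (f ∘ suc))) (cong (f zero * x +_) (sumFin-*ʳ n (f ∘ suc) x))

sumFin-nonneg : ∀ n {f : Fin n → ℚ} → (∀ i → 0ℚ ≤ f i) → 0ℚ ≤ sumFin n f
sumFin-nonneg zero    _   = ≤-refl
sumFin-nonneg (suc n) 0≤f = +-mono-≤ (0≤f zero) (sumFin-nonneg n (0≤f ∘ suc))

sumFin-last : ∀ n (f : Fin (suc n) → ℚ) →
              sumFin (suc n) f ≡ sumFin n (f ∘ inject₁) + f (fromℕ n)
sumFin-last zero    f = trans (+-identityʳ (f zero)) (sym (+-identityˡ (f zero)))
sumFin-last (suc n) f = begin
  f zero + sumFin (suc n) (f ∘ suc)                          ≡⟨ cong (f zero +_) (sumFin-last n (f ∘ suc)) ⟩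
  f zero + (sumFin n (f ∘ suc ∘ inject₁) + f (fromℕ (suc n))) ≡⟨ sym (+-assoc (f zero) _ _) ⟩
  sumFin (suc n) (f ∘ inject₁) + f (fromℕ (suc n))           ∎
  where open ≡-Reasoning

count-all : ∀ n → count n (λ _ → true) ≡ n
count-all zero    = refl
count-all (suc n) = cong suc (count-all n)


toℚ : ℕ → ℚ
toℚ n = mkℚ (ℤ.+ n) 0 (coprime-sym (1-coprimeTo n))

toℚ-suc : ∀ n → toℚ (suc n) ≡ 1ℚ + toℚ n
toℚ-suc n = sym (trans (/-cong {p₂ = ℤ.+ suc n} {q₂ = 1} (cong (ℤ._+_ (ℤ.+ 1)) (ℤ.*-identityʳ (ℤ.+ n))) refl)
                       (normalize-coprime (coprime-sym (1-coprimeTo (suc n)))))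

prefix-count : ∀ n d → d ℕ.≤ n → sumFin n (λ i → if toℕ i <ᵇ d then 1ℚ else 0ℚ) ≡ toℚ d
prefix-count n       zero    _         = sumFin-zeros n (λ _ → refl)
prefix-count (suc n) (suc d) (ℕ.s≤s d≤n) =
  trans (cong (1ℚ +_) (prefix-count n d d≤n)) (sym (toℚ-suc d))

unitFrac : ℕ → ℚ
unitFrac j = mkℚ (ℤ.+ 1) j (1-coprimeTo (suc j))

unitFrac-/ : ∀ j → (ℤ.+ 1) / suc j ≡ unitFrac j
unitFrac-/ j = normalize-coprime (1-coprimeTo (suc j))

unitFrac-inverse : ∀ j → toℚ (suc j) * unitFrac j ≡ 1ℚ
unitFrac-inverse j = *-inverseʳ (toℚ (suc j))

unitFrac-pos : ∀ j → 0ℚ <ℚ unitFrac j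
unitFrac-pos j = positive⁻¹ (unitFrac j)

unitFrac-antitone : ∀ {i j} → i ℕ.≤ j → unitFrac j ≤ unitFrac i
unitFrac-antitone {i} {j} i≤j =
  *≤* (ℤ.+≤+ (subst₂ ℕ._≤_ (sym (ℕ.*-identityˡ (suc i))) (sym (ℕ.*-identityˡ (suc j))) (ℕ.s≤s i≤j)))

unitFrac-reflects : ∀ {i j} → unitFrac j ≤ unitFrac i → i ℕ.≤ j
unitFrac-reflects {i} {j} (*≤* (ℤ.+≤+ le)) =
  ℕ.s≤s⁻¹ (subst₂ ℕ._≤_ (ℕ.*-identityˡ (suc i)) (ℕ.*-identityˡ (suc j)) le)


harmonic-suc : ∀ j → harmonic (suc j) ≡ harmonic j + unitFrac j
harmonic-suc j = begin
  harmonic (suc j)                                                ≡⟨ sumFin-last j term ⟩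
  sumFin j (term ∘ inject₁) + term (fromℕ j)                      ≡⟨ cong₂ _+_ (sumFin-cong j shift) last ⟩
  harmonic j + unitFrac j                                         ∎
  where
    open ≡-Reasoning
    term : Fin (suc j) → ℚ
    term i = (ℤ.+ 1) / suc (toℕ i)
    shift : ∀ i → term (inject₁ i) ≡ (ℤ.+ 1) / suc (toℕ i)
    shift i = cong (λ t → (ℤ.+ 1) / suc t) (toℕ-inject₁ i)
    last : term (fromℕ j) ≡ unitFrac j
    last = trans (cong (λ t → (ℤ.+ 1) / suc t) (toℕ-fromℕ j)) (unitFrac-/ j)

harmonic-nonneg : ∀ j → 0ℚ ≤ harmonic j
harmonic-nonneg j = sumFin-nonneg j (λ i → <⇒≤ (subst (0ℚ <ℚ_) (sym (unitFrac-/ (toℕ i))) (unitFrac-pos (toℕ i))))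


p≤q⇒0≤q-p : ∀ {p q} → p ≤ q → 0ℚ ≤ q - p
p≤q⇒0≤q-p {p} {q} p≤q = subst (_≤ q - p) (+-inverseʳ p) (+-monoˡ-≤ (- p) p≤q)

0≤q⇒p-q≤p : ∀ {p q} → 0ℚ ≤ q → p - q ≤ p
0≤q⇒p-q≤p {p} {q} 0≤q = subst (p - q ≤_) (+-identityʳ p) (+-monoʳ-≤ p (neg-antimono-≤ 0≤q))

load-equation : ∀ {S r t L} → S * r ≡ 1ℚ → (L * S ≡ 1ℚ + S * t) ⇔ (L ≡ t + r)
load-equation {S} {r} {t} {L} Sr≡1 = mk⇔ solved unsolved
  where
    open ≡-Reasoning
    solved : L * S ≡ 1ℚ + S * t → L ≡ t + r
    solved eq = begin
      L                        ≡⟨ sym (*-identityʳ L) ⟩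
      L * 1ℚ                   ≡⟨ cong (L *_) (sym Sr≡1) ⟩
      L * (S * r)              ≡⟨ sym (*-assoc L S r) ⟩
      L * S * r                ≡⟨ cong (_* r) eq ⟩
      (1ℚ + S * t) * r         ≡⟨ solve 3 (λ S r t → (con 1ℚ :+ S :* t) :* r := (S :* r) :* t :+ r) refl S r t ⟩
      (S * r) * t + r          ≡⟨ cong (λ x → x * t + r) Sr≡1 ⟩
      1ℚ * t + r               ≡⟨ cong (_+ r) (*-identityˡ t) ⟩
      t + r                    ∎
    unsolved : L ≡ t + r → L * S ≡ 1ℚ + S * t
    unsolved refl = begin
      (t + r) * S              ≡⟨ solve 3 (λ S r t → (t :+ r) :* S := S :* r :+ S :* t) refl S r t ⟩
      S * r + S * t            ≡⟨ cong (_+ S * t) Sr≡1 ⟩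
      1ℚ + S * t               ∎

+-cancelˡ-≤ : ∀ t {a b} → t + a ≤ t + b → a ≤ b
+-cancelˡ-≤ t {a} {b} le = subst₂ _≤_ (cancel a) (cancel b) (+-monoʳ-≤ (- t) le)
  where
    cancel : ∀ x → - t + (t + x) ≡ x
    cancel x = solve 2 (λ t x → (:- t) :+ (t :+ x) := x) refl t x

nonneg-product : ∀ {p q} → 0ℚ ≤ p → 0ℚ ≤ q → 0ℚ ≤ p * q
nonneg-product {p} {q} 0≤p 0≤q = subst (_≤ p * q) (*-zeroˡ q) (*-monoʳ-≤-nonNeg q {{nonNegative 0≤q}} 0≤p)

nonneg-factor : ∀ {p q} → 0ℚ <ℚ q → 0ℚ ≤ p * q → 0ℚ ≤ p
nonneg-factor {p} {q} q>0 0≤pq =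
  *-cancelʳ-≤-pos {0ℚ} {p} q {{positive q>0}} (subst (_≤ p * q) (sym (*-zeroˡ q)) 0≤pq)

÷-*-cancel : ∀ p q .{{_ : NonZero q}} → (p ÷ q) * q ≡ p
÷-*-cancel p q = trans (*-assoc p (1/ q) q) (trans (cong (p *_) (*-inverseˡ q)) (*-identityʳ p))

below-reciprocal : ∀ {H ε v x} → 0ℚ <ℚ ε → 0ℚ ≤ H → 0ℚ ≤ v → v ≤ x → x * H ≡ 1ℚ →
                   (H - ε) * v ≤ 1ℚ
below-reciprocal {H} {ε} {v} {x} ε>0 H≥0 v≥0 v≤x xH≡1 = begin
  (H - ε) * v     ≤⟨ *-monoʳ-≤-nonNeg v {{nonNegative v≥0}} (0≤q⇒p-q≤p {H} (<⇒≤ ε>0)) ⟩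
  H * v           ≤⟨ *-monoˡ-≤-nonNeg H {{nonNegative H≥0}} v≤x ⟩
  H * x           ≡⟨ trans (*-comm H x) xH≡1 ⟩
  1ℚ              ∎
  where open ≤-Reasoning


module _ (El : Election) where
  open Election El

  elect : Committee El → Fin nc → Committee El
  elect A c⋆ c = if does (c ≟ c⋆) then true else A c

  updateWeights : Weights El → (Fin nv → ℚ) → Fin nc → (Fin nc → ℚ) → Weights El
  updateWeights w ℓ c⋆ L n c =
    if does (c ≟ c⋆) then (if edge n c⋆ then L c⋆ - ℓ n else w n c) else w n c

  updateLoads : (Fin nv → ℚ) → Fin nc → (Fin nc → ℚ) → Fin nv → ℚ
  updateLoads ℓ c⋆ L n = if edge n c⋆ then L c⋆ else ℓ n

  elect-self : ∀ A c → elect A c c ≡ true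
  elect-self A c rewrite dec-true (c ≟ c) refl = refl

  updateLoads-approver : ∀ {ℓ c⋆ L n} → edge n c⋆ ≡ true → updateLoads ℓ c⋆ L n ≡ L c⋆
  updateLoads-approver approves rewrite approves = refl

  updateWeights-approver : ∀ {w ℓ c⋆ L n} → edge n c⋆ ≡ true →
                           updateWeights w ℓ c⋆ L n c⋆ ≡ L c⋆ - ℓ n
  updateWeights-approver {c⋆ = c⋆} approves rewrite dec-true (c⋆ ≟ c⋆) refl | approves = refl

  loadedStrength-shared : ∀ {ℓ c t} → (∀ n → edge n c ≡ true → ℓ n ≡ t) →
                          loadedStrength El ℓ c ≡ approvalStrength El c * t
  loadedStrength-shared {ℓ} {c} {t} shared =
    trans (sumFin-cong nv term) (sym (sumFin-*ʳ nv (λ n → if edge n c then strength n else 0ℚ) t))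
    where
      term : ∀ n → (if edge n c then strength n * ℓ n else 0ℚ) ≡ (if edge n c then strength n else 0ℚ) * t
      term n with edge n c in approves
      ... | true  = cong (strength n *_) (shared n approves)
      ... | false = sym (*-zeroˡ t)

  candidate-load : ∀ {ℓ c t r L} → (∀ n → edge n c ≡ true → ℓ n ≡ t) →
                   approvalStrength El c * r ≡ 1ℚ →
                   (L * approvalStrength El c ≡ 1ℚ + loadedStrength El ℓ c) ⇔ (L ≡ t + r)
  candidate-load {ℓ} {c} {t} {r} {L} shared Sr≡1
    rewrite loadedStrength-shared {ℓ} {c} {t} shared = load-equation Sr≡1

  record LoadBounds (w : Weights El) (ℓ : Fin nv → ℚ) : Set where
    field
      load-nonneg   : ∀ n → 0ℚ ≤ ℓ n
      weight-nonneg : ∀ n c → 0ℚ ≤ w n c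
      weight≤load   : ∀ n c → w n c ≤ ℓ n

  initial-bounds : LoadBounds (λ _ _ → 0ℚ) (λ _ → 0ℚ)
  initial-bounds = record
    { load-nonneg = λ _ → ≤-refl ; weight-nonneg = λ _ _ → ≤-refl ; weight≤load = λ _ _ → ≤-refl }

  step-bounds : ∀ {w ℓ c⋆ L} → LoadBounds w ℓ → (∀ n → edge n c⋆ ≡ true → ℓ n ≤ L c⋆) →
                LoadBounds (updateWeights w ℓ c⋆ L) (updateLoads ℓ c⋆ L)
  step-bounds {w} {ℓ} {c⋆} {L} bounds raises = record
    { load-nonneg   = λ n → ≤-trans (load-nonneg n) (raised n (edge n c⋆) (raises n))
    ; weight-nonneg = λ n c → proj₁ (new-weight n c)
    ; weight≤load   = λ n c → proj₂ (new-weight n c)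
    }
    where
      open LoadBounds bounds
      raised : ∀ n b → (b ≡ true → ℓ n ≤ L c⋆) → ℓ n ≤ (if b then L c⋆ else ℓ n)
      raised n true  ℓ≤L = ℓ≤L refl
      raised n false _   = ≤-refl
      fresh : ∀ n c b → (b ≡ true → ℓ n ≤ L c⋆) →
                0ℚ ≤ (if b then L c⋆ - ℓ n else w n c)
              × (if b then L c⋆ - ℓ n else w n c) ≤ (if b then L c⋆ else ℓ n)
      fresh n c true  ℓ≤L = p≤q⇒0≤q-p (ℓ≤L refl) , 0≤q⇒p-q≤p (load-nonneg n)
      fresh n c false _   = weight-nonneg n c , weight≤load n c
      new-weight : ∀ n c → 0ℚ ≤ updateWeights w ℓ c⋆ L n c
                         × updateWeights w ℓ c⋆ L n c ≤ updateLoads ℓ c⋆ L n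
      new-weight n c with does (c ≟ c⋆)
      ... | true  = fresh n c (edge n c⋆) (raises n)
      ... | false = weight-nonneg n c , ≤-trans (weight≤load n c) (raised n (edge n c⋆) (raises n))

  -- The final rescaling w_{nc} ↦ w_{nc} s_n / ℓ(n) is well defined under the
  -- bounds: a positive weight forces a positive load.
  rescale : ∀ {w ℓ} → LoadBounds w ℓ →
            Σ (Weights El) λ w′ →
                (∀ n c → 0ℚ <ℚ w n c → w′ n c * ℓ n ≡ w n c * strength n)
              × (∀ n c → ¬ (0ℚ <ℚ w n c) → w′ n c ≡ w n c)
  rescale {w} {ℓ} bounds = rescaled , rescaled-positive , rescaled-other
    where
      open LoadBounds bounds
      positive-load : ∀ n c → 0ℚ <ℚ w n c → NonZero (ℓ n)
      positive-load n c w>0 = pos⇒nonZero (ℓ n) {{positive (<-≤-trans w>0 (weight≤load n c))}}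
      rescaled : Weights El
      rescaled n c with 0ℚ <? w n c
      ... | yes w>0 = (w n c * strength n ÷ ℓ n) {{positive-load n c w>0}}
      ... | no  _   = w n c
      rescaled-positive : ∀ n c → 0ℚ <ℚ w n c → rescaled n c * ℓ n ≡ w n c * strength n
      rescaled-positive n c w>0 with 0ℚ <? w n c
      ... | yes w>0′ = ÷-*-cancel (w n c * strength n) (ℓ n) {{positive-load n c w>0′}}
      ... | no  w≯0  = contradiction w>0 w≯0
      rescaled-other : ∀ n c → ¬ (0ℚ <ℚ w n c) → rescaled n c ≡ w n c
      rescaled-other n c w≯0 with 0ℚ <? w n c
      ... | yes w>0 = contradiction w>0 w≯0
      ... | no  _   = refl

  rescaled-nonneg : ∀ {w w′ : Weights El} {ℓ} → LoadBounds w ℓ →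
                    (∀ n c → 0ℚ <ℚ w n c → w′ n c * ℓ n ≡ w n c * strength n) →
                    (∀ n c → ¬ (0ℚ <ℚ w n c) → w′ n c ≡ w n c) →
                    ∀ n c → 0ℚ ≤ w′ n c
  rescaled-nonneg {w} {w′} {ℓ} bounds on-positive elsewhere n c = by-sign (0ℚ <? w n c)
    where
      open LoadBounds bounds
      by-sign : Dec (0ℚ <ℚ w n c) → 0ℚ ≤ w′ n c
      by-sign (yes w>0) = nonneg-factor (<-≤-trans w>0 (weight≤load n c))
        (subst (0ℚ ≤_) (sym (on-positive n c w>0)) (nonneg-product (weight-nonneg n c) (strength-nonneg n)))
      by-sign (no  w≯0) = subst (0ℚ ≤_) (sym (elsewhere n c w≯0)) (weight-nonneg n c)

  supp-nonneg : ∀ {w} → (∀ n c → 0ℚ ≤ w n c) → ∀ c → 0ℚ ≤ supp El w c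
  supp-nonneg w≥0 c = sumFin-nonneg nv (λ n → if-nonneg (edge n c) (w≥0 n c))


module Staircase (m : ℕ) where

  K : ℕ
  K = suc m

  deg : Fin (suc K) → ℕ
  deg c = suc (pred (toℕ c))

  approves : Fin K → Fin (suc K) → Bool
  approves n c = toℕ n <ᵇ deg c

  approves-next : ∀ n → approves n (suc n) ≡ true
  approves-next n = <ᵇ-true (ℕ.n<1+n (toℕ n))

  El : Election
  El = record
    { nv = K ; nc = suc K ; edge = approves ; strength = λ _ → 1ℚ
    ; strength-nonneg       = λ _ → <⇒≤ (unitFrac-pos 0)
    ; voter-nonisolated     = λ n → suc n , approves-next n
    ; candidate-nonisolated = λ c → zero , refl
    }

  approvalStrength-deg : ∀ c → approvalStrength El c ≡ toℚ (deg c)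
  approvalStrength-deg c = prefix-count K (deg c) (ℕ.s≤s (ℕ.pred-mono-≤ (toℕ≤pred[n] c)))

  -- load i = 1/K + 1/(K-1) + ... + 1/(K-i+1): the common load, after i rounds,
  -- of all voters that approve some unelected candidate.
  load : ℕ → ℚ
  load zero    = 0ℚ
  load (suc i) = load i + unitFrac (m ∸ i)

  load-rises : ∀ i → load i ≤ load (suc i)
  load-rises i = subst (_≤ load (suc i)) (+-identityʳ (load i)) (+-monoʳ-≤ (load i) (<⇒≤ (unitFrac-pos (m ∸ i))))

  load-harmonic : ∀ i j → i ℕ.+ j ≡ K → load i + harmonic j ≡ harmonic K
  load-harmonic zero    j refl = +-identityˡ (harmonic j)
  load-harmonic (suc i) j i+j≡K = begin
    load i + unitFrac (m ∸ i) + harmonic j    ≡⟨ cong (λ t → load i + unitFrac t + harmonic j) m∸i≡j ⟩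
    load i + unitFrac j + harmonic j          ≡⟨ +-assoc (load i) (unitFrac j) (harmonic j) ⟩
    load i + (unitFrac j + harmonic j)        ≡⟨ cong (load i +_) (+-comm (unitFrac j) (harmonic j)) ⟩
    load i + (harmonic j + unitFrac j)        ≡⟨ cong (load i +_) (sym (harmonic-suc j)) ⟩
    load i + harmonic (suc j)                 ≡⟨ load-harmonic i (suc j) (trans (ℕ.+-suc i j) i+j≡K) ⟩
    harmonic K                                ∎
    where
      open ≡-Reasoning
      m∸i≡j : m ∸ i ≡ j
      m∸i≡j = trans (cong (_∸ i) (sym (ℕ.suc-injective i+j≡K))) (ℕ.m+n∸m≡n i j)

  load-final : load K ≡ harmonic K
  load-final = trans (sym (+-identityʳ (load K))) (load-harmonic K 0 (ℕ.+-identityʳ K))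

  record Invariant (i : ℕ) (A : Committee El) (w : Weights El) (ℓ : Fin K → ℚ) : Set where
    field
      elected   : ∀ c → A c ≡ true  → suc (m ∸ i) < toℕ c
      unelected : ∀ c → A c ≡ false → toℕ c ℕ.≤ suc (m ∸ i)
      shared    : ∀ n → toℕ n ℕ.≤ m ∸ i → ℓ n ≡ load i
      bounds    : LoadBounds El w ℓ

  invariant-start : Invariant 0 (λ _ → false) (λ _ _ → 0ℚ) (λ _ → 0ℚ)
  invariant-start = record
    { elected = λ _ () ; unelected = λ c _ → toℕ≤pred[n] c ; shared = λ _ _ → refl
    ; bounds = initial-bounds El }

  record Round (i : ℕ) (ℓ : Fin K → ℚ) (c⋆ : Fin (suc K)) (L : Fin (suc K) → ℚ) : Set where
    field
      degree   : pred (toℕ c⋆) ≡ m ∸ i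
      new-load : L c⋆ ≡ load (suc i)
      raises   : ∀ n → approves n c⋆ ≡ true → ℓ n ≤ L c⋆

  module _ {i A w ℓ} (inv : Invariant i A w ℓ) where
    open Invariant inv

    -- The approvers of an unelected candidate c are voters 0..deg c - 1 with deg c ≤ m - i + 1.
    approvers-share : ∀ {c} → A c ≡ false → ∀ n → approves n c ≡ true → ℓ n ≡ load i
    approvers-share {c} c∉A n approves =
      shared n (ℕ.≤-trans (ℕ.s≤s⁻¹ (<ᵇ-sound approves)) (ℕ.pred-mono-≤ (unelected c c∉A)))

    unelected-load : ∀ {c} → A c ≡ false → (L : ℚ) →
                     (L * approvalStrength El c ≡ 1ℚ + loadedStrength El ℓ c)
                       ⇔ (L ≡ load i + unitFrac (pred (toℕ c)))
    unelected-load {c} c∉A L = candidate-load El {c = c} (approvers-share c∉A)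
      (trans (cong (_* unitFrac (pred (toℕ c))) (approvalStrength-deg c)) (unitFrac-inverse (pred (toℕ c))))

    -- The unelected candidate of largest degree, namely m - i + 1.
    top-bound : suc (m ∸ i) < suc K
    top-bound = ℕ.s≤s (ℕ.s≤s (ℕ.m∸n≤m m i))

    top : Fin (suc K)
    top = fromℕ< top-bound

    toℕ-top : toℕ top ≡ suc (m ∸ i)
    toℕ-top = toℕ-fromℕ< top-bound

    pred-top : pred (toℕ top) ≡ m ∸ i
    pred-top = cong pred toℕ-top

    top-unelected : A top ≡ false
    top-unelected with A top in top∈A
    ... | false = refl
    ... | true  = contradiction (subst (suc (m ∸ i) <_) toℕ-top (elected top top∈A)) (ℕ.<-irrefl refl)

    round : ∀ {c⋆ L} → A c⋆ ≡ false →
            (∀ c → A c ≡ false → L c * approvalStrength El c ≡ 1ℚ + loadedStrength El ℓ c) →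
            (∀ c → A c ≡ false → L c⋆ ≤ L c) →
            Round i ℓ c⋆ L
    round {c⋆} {L} c⋆∉A loads minimal = record
      { degree   = degree
      ; new-load = new-load
      ; raises   = λ n approves → subst₂ _≤_ (sym (approvers-share c⋆∉A n approves)) (sym new-load) (load-rises i)
      }
      where
        load-of : ∀ {c} → A c ≡ false → L c ≡ load i + unitFrac (pred (toℕ c))
        load-of {c} c∉A = Equivalence.to (unelected-load c∉A (L c)) (loads c c∉A)
        -- c⋆ is at least as cheap as the top candidate, so its degree is maximal.
        beats-top : unitFrac (pred (toℕ c⋆)) ≤ unitFrac (m ∸ i)
        beats-top = +-cancelˡ-≤ (load i) (subst₂ _≤_ (load-of c⋆∉A)
                      (trans (load-of top-unelected) (cong (λ j → load i + unitFrac j) pred-top))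
                      (minimal top top-unelected))
        degree : pred (toℕ c⋆) ≡ m ∸ i
        degree = ℕ.≤-antisym (ℕ.pred-mono-≤ (unelected c⋆ c⋆∉A)) (unitFrac-reflects beats-top)
        new-load : L c⋆ ≡ load (suc i)
        new-load = trans (load-of c⋆∉A) (cong (λ j → load i + unitFrac j) degree)

  invariant-step : ∀ {i A w ℓ c⋆ L} → suc i ℕ.≤ m → Invariant i A w ℓ → A c⋆ ≡ false →
                   (∀ c → A c ≡ false → L c * approvalStrength El c ≡ 1ℚ + loadedStrength El ℓ c) →
                   (∀ c → A c ≡ false → L c⋆ ≤ L c) →
                   Invariant (suc i) (elect El A c⋆) (updateWeights El w ℓ c⋆ L) (updateLoads El ℓ c⋆ L)
  invariant-step {i} {A} {w} {ℓ} {c⋆} {L} i<m inv c⋆∉A loads minimal = record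
    { elected = elected′ ; unelected = unelected′ ; shared = shared′
    ; bounds  = step-bounds El {w} {ℓ} {c⋆} {L} bounds raises }
    where
      open Invariant inv
      open Round (round inv c⋆∉A loads minimal)
      remaining : m ∸ i ≡ suc (m ∸ suc i)
      remaining = ℕ.+-∸-assoc 1 i<m
      position : toℕ c⋆ ≡ suc (m ∸ i)
      position = trans (sym (ℕ.suc-pred (toℕ c⋆) {{ℕ.≢-nonZero nonzero}})) (cong suc degree)
        where
          nonzero : toℕ c⋆ ≢ 0
          nonzero c⋆≡0 = ℕ.0≢1+n (trans (sym (cong pred c⋆≡0)) (trans degree remaining))
      elected′ : ∀ c → elect El A c⋆ c ≡ true → suc (m ∸ suc i) < toℕ c
      elected′ c c∈A′ with c ≟ c⋆
      ... | yes refl = subst (suc (m ∸ suc i) <_) (sym (trans position (cong suc remaining))) (ℕ.n<1+n _)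
      ... | no  _    = ℕ.<-trans (subst (suc (m ∸ suc i) <_) (cong suc (sym remaining)) (ℕ.n<1+n _)) (elected c c∈A′)
      unelected′ : ∀ c → elect El A c⋆ c ≡ false → toℕ c ℕ.≤ suc (m ∸ suc i)
      unelected′ c c∉A′ with c ≟ c⋆
      unelected′ c ()   | yes _
      ... | no c≢c⋆ = subst (toℕ c ℕ.≤_) remaining (ℕ.s≤s⁻¹ (ℕ.≤∧≢⇒< (unelected c c∉A′)
                        (λ c≡top → c≢c⋆ (toℕ-injective (trans c≡top (sym position))))))
      shared′ : ∀ n → toℕ n ℕ.≤ m ∸ suc i → updateLoads El ℓ c⋆ L n ≡ load (suc i)
      shared′ n n≤ = trans (updateLoads-approver El {ℓ} {c⋆} {L} {n} approves-c⋆) new-load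
        where
          approves-c⋆ : approves n c⋆ ≡ true
          approves-c⋆ = <ᵇ-true (ℕ.s≤s (subst (toℕ n ℕ.≤_) (sym degree)
                          (ℕ.≤-trans n≤ (ℕ.∸-monoʳ-≤ m (ℕ.n≤1+n i)))))

  invariant : ∀ i {A w ℓ} → i ℕ.≤ m → PhragmenState El i A w ℓ → Invariant i A w ℓ
  invariant zero    _   start = invariant-start
  invariant (suc i) i<m (step st c⋆ c⋆∉A L loads minimal) =
    invariant-step i<m (invariant i (ℕ.<⇒≤ i<m) st) c⋆∉A loads minimal

  record FinalState (A : Committee El) (w : Weights El) (ℓ : Fin K → ℚ) : Set where
    field
      last         : Fin (suc K)
      last-elected : A last ≡ true
      sole-backer  : ∀ n → n ≢ zero → approves n last ≡ false
      last-weight  : w zero last ≡ 1ℚ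
      last-load    : ℓ zero ≡ harmonic K
      bounds       : LoadBounds El w ℓ

  final-state : ∀ {A w ℓ} → PhragmenState El K A w ℓ → FinalState A w ℓ
  final-state (step {A = A} {w} {ℓ} st c⋆ c⋆∉A L loads minimal) = record
    { last         = c⋆
    ; last-elected = elect-self El A c⋆
    ; sole-backer  = λ n n≢0 → <ᵇ-false (subst (ℕ._≤ toℕ n) (cong suc (sym degree-one))
                                               (ℕ.n≢0⇒n>0 (n≢0 ∘ toℕ-injective {j = zero})))
    ; last-weight  = trans (updateWeights-approver El {w} {ℓ} {c⋆} {L} {zero} refl) last-weight
    ; last-load    = trans (updateLoads-approver El {ℓ} {c⋆} {L} {zero} refl) (trans new-load load-final)
    ; bounds       = step-bounds El {w} {ℓ} {c⋆} {L} (Invariant.bounds inv) raises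
    }
    where
      inv : Invariant m A w ℓ
      inv = invariant m ℕ.≤-refl st
      open Round (round inv c⋆∉A loads minimal)
      degree-one : pred (toℕ c⋆) ≡ 0
      degree-one = trans degree (ℕ.n∸n≡0 m)
      last-weight : L c⋆ - ℓ zero ≡ 1ℚ
      last-weight = begin
        L c⋆ - ℓ zero                          ≡⟨ cong₂ _-_ new-load (Invariant.shared inv zero ℕ.z≤n) ⟩
        load m + unitFrac (m ∸ m) - load m
          ≡⟨ solve 2 (λ a b → a :+ b :- a := b) refl (load m) (unitFrac (m ∸ m)) ⟩
        unitFrac (m ∸ m)                       ≡⟨ cong unitFrac (ℕ.n∸n≡0 m) ⟩
        1ℚ                                     ∎
        where open ≡-Reasoning

  Reachable : ℕ → Set
  Reachable i = Σ (Committee El) λ A → Σ (Weights El) λ w → Σ (Fin K → ℚ) λ ℓ → PhragmenState El i A w ℓ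

  -- Before the last round, Phragmén can always proceed: elect the top
  -- candidate, every unelected candidate having load load i + 1/deg c.
  extend : ∀ {i} → i ℕ.≤ m → Reachable i → Reachable (suc i)
  extend {i} i≤m (A , w , ℓ , st) = _ , _ , _ , step st (top inv) (top-unelected inv) L loads minimal
    where
      inv : Invariant i A w ℓ
      inv = invariant i i≤m st
      L : Fin (suc K) → ℚ
      L c = load i + unitFrac (pred (toℕ c))
      loads : ∀ c → A c ≡ false → L c * approvalStrength El c ≡ 1ℚ + loadedStrength El ℓ c
      loads c c∉A = Equivalence.from (unelected-load inv c∉A (L c)) refl
      minimal : ∀ c → A c ≡ false → L (top inv) ≤ L c
      minimal c c∉A = +-monoʳ-≤ (load i) (unitFrac-antitone
        (subst (pred (toℕ c) ℕ.≤_) (sym (pred-top inv)) (ℕ.pred-mono-≤ (Invariant.unelected inv c c∉A))))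

  reach : ∀ i → i ℕ.≤ K → Reachable i
  reach zero    _   = _ , _ , _ , start
  reach (suc i) i<K = extend (ℕ.s≤s⁻¹ i<K) (reach i (ℕ.<⇒≤ i<K))

  phragmen-output : Σ (Committee El) λ A → Σ (Weights El) λ w′ → PhragmenOutput El K A w′
  phragmen-output =
    let (A , w , ℓ , st) = reach K ℕ.≤-refl
        (w′ , on-positive , elsewhere) = rescale El (FinalState.bounds (final-state st))
    in A , w′ , w , ℓ , st , on-positive , elsewhere

  phragmen-bound : ∀ {ε A w′ v} → 0ℚ <ℚ ε → PhragmenOutput El K A w′ → IsSuppOf El w′ A v →
                   (harmonic K - ε) * v ≤ 1ℚ
  phragmen-bound {w′ = w′} {v} ε>0 (w , ℓ , st , on-positive , elsewhere) ((c₀ , _ , supp≡v) , v≤supp) =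
    below-reciprocal ε>0 (harmonic-nonneg K) v≥0 v≤x x*H≡1
    where
      open FinalState (final-state st)
      x : ℚ
      x = w′ zero last
      v≥0 : 0ℚ ≤ v
      v≥0 = subst (0ℚ ≤_) supp≡v (supp-nonneg El (rescaled-nonneg El bounds on-positive elsewhere) c₀)
      supp-last : supp El w′ last ≡ x
      supp-last = sumFin-single K {λ n → if approves n last then w′ n last else 0ℚ} zero
                    (λ n n≢0 → if-off (sole-backer n n≢0))
      v≤x : v ≤ x
      v≤x = subst (v ≤_) supp-last (v≤supp last last-elected)
      x*H≡1 : x * harmonic K ≡ 1ℚ
      x*H≡1 = begin
        x * harmonic K       ≡⟨ cong (x *_) (sym last-load) ⟩
        x * ℓ zero           ≡⟨ on-positive zero last (subst (0ℚ <ℚ_) (sym last-weight) (unitFrac-pos 0)) ⟩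
        w zero last * 1ℚ     ≡⟨ trans (*-identityʳ (w zero last)) last-weight ⟩
        1ℚ                   ∎
        where open ≡-Reasoning

  optimal : Committee El
  optimal zero    = false
  optimal (suc _) = true

  optimalWeights : Weights El
  optimalWeights n c = if does (c ≟ suc n) then 1ℚ else 0ℚ

  optimal-size : count (suc K) optimal ≡ K
  optimal-size = count-all K

  own-entry : ∀ n → (if approves n (suc n) then optimalWeights n (suc n) else 0ℚ) ≡ 1ℚ
  own-entry n rewrite approves-next n | dec-true (suc n ≟ suc n) refl = refl

  other-entry : ∀ n c → c ≢ suc n → (if approves n c then optimalWeights n c else 0ℚ) ≡ 0ℚ
  other-entry n c c≢n+1 =
    if-zero (approves n c) (cong (λ b → if b then 1ℚ else 0ℚ) (dec-false (c ≟ suc n) c≢n+1))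

  optimal-feasible : Feasible El optimalWeights
  optimal-feasible = nonneg , off-edges , budget
    where
      nonneg : ∀ n c → 0ℚ ≤ optimalWeights n c
      nonneg n c with does (c ≟ suc n)
      ... | true  = <⇒≤ (unitFrac-pos 0)
      ... | false = ≤-refl
      off-edges : ∀ n c → approves n c ≡ false → optimalWeights n c ≡ 0ℚ
      off-edges n c ¬approves with c ≟ suc n
      ... | yes refl = contradiction (trans (sym (approves-next n)) ¬approves) λ ()
      ... | no  _    = refl
      budget : ∀ n → sumFin (suc K) (λ c → if approves n c then optimalWeights n c else 0ℚ) ≤ 1ℚ
      budget n = ≤-reflexive (trans (sumFin-single (suc K) (suc n) (other-entry n)) (own-entry n))

  optimal-support-one : ∀ c → supp El optimalWeights (suc c) ≡ 1ℚ
  optimal-support-one c =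
    trans (sumFin-single K c (λ n n≢c → other-entry n (suc c) (n≢c ∘ sym ∘ suc-injective))) (own-entry c)

  optimal-support : IsSuppOf El optimalWeights optimal 1ℚ
  optimal-support = (suc zero , refl , optimal-support-one zero) , members
    where
      members : ∀ c → optimal c ≡ true → 1ℚ ≤ supp El optimalWeights c
      members zero    ()
      members (suc c) _  = ≤-reflexive (sym (optimal-support-one c))


lemma5 : (k : ℕ) → 0 < k → (ε : ℚ) → 0ℚ <ℚ ε →
    Σ Election λ El →
        k < Election.nc El
      × (∀ n → 0ℚ <ℚ Election.strength El n)
      × (Σ (Committee El) λ A → Σ (Weights El) λ w → PhragmenOutput El k A w)
      × (Σ (Committee El) λ Aopt → Σ (Weights El) λ wopt → Σ ℚ λ vopt →
            count (Election.nc El) Aopt ≡ k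
          × Feasible El wopt
          × IsSuppOf El wopt Aopt vopt
          × (∀ A w v → PhragmenOutput El k A w → IsSuppOf El w A v →
               (harmonic k - ε) * v ≤ vopt))
lemma5 zero    ()
lemma5 (suc m) _  ε ε>0 =
  El , ℕ.n<1+n K , (λ _ → unitFrac-pos 0) , phragmen-output ,
  optimal , optimalWeights , 1ℚ , optimal-size , optimal-feasible , optimal-support ,
  (λ _ _ _ output support → phragmen-bound ε>0 output support)
  where open Staircase m
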